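{- Let polynomials $\mathrm{err}'(n,i)\in\mathbb{Z}[u_1,u_2,u_3]$, $n\ge0$, $i\in\{ -1,0,1\}$, be defined by $\mathrm{err}'(0,0)=u_1^2+u_1u_2+u_2^2$, $\mathrm{err}'(0,1)=u_1+u_2$, $\mathrm{err}'(0,-1)=1+u_3(u_1+u_2)$ and, writing $A=\mathrm{err}'(n,-1)$, $B=\mathrm{err}'(n,0)$, $C=\mathrm{err}'(n,1)$, $s=u_1+u_2$, $p=u_1u_2$, $q=u_3^{2^{n+1}}$: \[ \mathrm{err}'(n+1,0)=B\,(AB-ACp\,u_3+B^2q), \] \[ \mathrm{err}'(n+1,1)=B\,(AC+AB\,u_3-ACs\,u_3+BCq), \] \[ \mathrm{err}'(n+1,-1)=A\,(A^2-A^2s\,u_3+A^2p\,u_3^2+3ABq+2B^2u_3^{2^{n+2}}-ABs\,u_3^{1+2^{n+1}}-ACp\,u_3^{1+2^{n+1}}). \] Then, regarding these as polynomials in $u_3$ with $u_1,u_2$ indeterminates, for all $n\ge0$: $\deg_{u_3}\mathrm{err}'(n,-1)=2\cdot3^n-1$, $\deg_{u_3}\mathrm{err}'(n,0)=2(3^n-2^n)$, and $\deg_{u_3}\mathrm{err}'(n,1)=2(3^n-2^n)$.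
   Context: These recurrences are obtained from Newton–Raphson-type iteration (NRS(2)) for a cubic polynomial $\prod_{i=1}^3(1-u_iz)$ after changes of variables; only the recurrences stated are needed. -}

module Defs where

open import Data.Nat using (ℕ; zero; suc; _∸_; _<_) renaming (_+_ to _+ℕ_)
open import Data.Integer using (ℤ; +_; 0ℤ; 1ℤ) renaming (_+_ to _+ℤ_; _*_ to _*ℤ_)
open import Data.Product using (_×_; ∃₂)
open import Relation.Binary.PropositionalEquality using (_≡_; _≢_)

-- Elements of ℤ[[u₁,u₂,u₃]] given by their coefficient function:
-- f a b c = coefficient of u₁^a u₂^b u₃^c.  ℤ[u₁,u₂,u₃] embeds as a subring,
-- so computing the (polynomial) err' here gives the same coefficients.
Ser : Set
Ser = ℕ → ℕ → ℕ → ℤ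

sumTo : ℕ → (ℕ → ℤ) → ℤ
sumTo zero    g = g 0
sumTo (suc n) g = sumTo n g +ℤ g (suc n)

infixl 6 _⊕_
infixl 7 _⊗_

_⊕_ : Ser → Ser → Ser
(f ⊕ g) a b c = f a b c +ℤ g a b c

_⊗_ : Ser → Ser → Ser
(f ⊗ g) a b c =
  sumTo a λ i → sumTo b λ j → sumTo c λ k →
    f i j k *ℤ g (a ∸ i) (b ∸ j) (c ∸ k)

cst : ℤ → Ser
cst z zero zero zero = z
cst z _    _    _    = 0ℤ

one : Ser
one = cst 1ℤ

u₁ u₂ u₃ : Ser
u₁ (suc zero) zero zero = 1ℤ
u₁ _ _ _ = 0ℤ
u₂ zero (suc zero) zero = 1ℤ
u₂ _ _ _ = 0ℤ
u₃ zero zero (suc zero) = 1ℤ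
u₃ _ _ _ = 0ℤ

infixr 8 _^ˢ_
_^ˢ_ : Ser → ℕ → Ser
f ^ˢ zero  = one
f ^ˢ suc n = f ⊗ (f ^ˢ n)

sˢ pˢ : Ser
sˢ = u₁ ⊕ u₂
pˢ = u₁ ⊗ u₂

record Triple : Set where
  constructor ⟨_,_,_⟩
  field
    A : Ser
    B : Ser
    C : Ser
open Triple public

errT : ℕ → Triple
errT zero = ⟨ one ⊕ u₃ ⊗ (u₁ ⊕ u₂)
            , u₁ ⊗ u₁ ⊕ u₁ ⊗ u₂ ⊕ u₂ ⊗ u₂
            , u₁ ⊕ u₂ ⟩
errT (suc n) with errT n
... | ⟨ a , b , c ⟩ =
  let q  = u₃ ^ˢ (2 ^ (suc n))
      q2 = u₃ ^ˢ (2 ^ (suc (suc n)))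
      r  = u₃ ^ˢ (1 +ℕ 2 ^ (suc n))
  in
  ⟨ a ⊗ (a ⊗ a ⊕ cst (Data.Integer.-_ 1ℤ) ⊗ a ⊗ a ⊗ sˢ ⊗ u₃ ⊕ a ⊗ a ⊗ pˢ ⊗ (u₃ ⊗ u₃)
         ⊕ cst (+ 3) ⊗ a ⊗ b ⊗ q ⊕ cst (+ 2) ⊗ b ⊗ b ⊗ q2
         ⊕ cst (Data.Integer.-_ 1ℤ) ⊗ a ⊗ b ⊗ sˢ ⊗ r
         ⊕ cst (Data.Integer.-_ 1ℤ) ⊗ a ⊗ c ⊗ pˢ ⊗ r)
  , b ⊗ (a ⊗ b ⊕ cst (Data.Integer.-_ 1ℤ) ⊗ a ⊗ c ⊗ pˢ ⊗ u₃ ⊕ b ⊗ b ⊗ q)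
  , b ⊗ (a ⊗ c ⊕ a ⊗ b ⊗ u₃ ⊕ cst (Data.Integer.-_ 1ℤ) ⊗ a ⊗ c ⊗ sˢ ⊗ u₃ ⊕ b ⊗ c ⊗ q) ⟩
  where open Data.Nat using (_^_)
        import Data.Integer

errM1 err0 err1 : ℕ → Ser
errM1 n = A (errT n)
err0  n = B (errT n)
err1  n = C (errT n)

DegU3 : Ser → ℕ → Set
DegU3 f d = (∃₂ λ a b → f a b d ≢ 0ℤ) × (∀ a b k → d < k → f a b k ≡ 0ℤ)

-- Record for a polynomial f a bound d on its u₃-degree together with the coefficient of
-- u₃^d in f(u₁, 0, u₃).  For err'(n,-1), err'(n,0), err'(n,1) this coefficient is the
-- monomial u₁^m, u₁^(m+1), u₁^m respectively.  Since monomials multiply without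
-- cancellation, the data of a product is the product of the data, and data with equal d
-- and m add.  Setting u₂ = 0 kills every term containing p = u₁u₂, so in each recursion
-- formula only the p-free terms of top u₃-degree contribute, with coefficients 2 - 1, 1 and
-- 1 - 1 + 1: the top coefficients are again u₁-monomials with coefficient 1.  Being
-- nonzero, they make the bounds exact, and the bounds satisfy
-- deg err'(n,-1) + 1 = deg err'(n,0) + 2^(n+1) = 2·3^n.
module Submission where

open import Defs
open import Data.Nat using (ℕ; zero; suc; _+_; _*_; _^_; _∸_; _≤_; _<_; z≤n; s≤s; _≟_)
open import Data.Nat.Properties
  using ( ≤-refl; ≤-reflexive; ≤-trans; <-trans; <⇒≢; ≤∧≢⇒<; ≤-pred; <-cmp; ≤-<-connex
        ; m≤n⇒m≤1+n; n≤1+n; n<1+n; m≤m+n; +-monoˡ-≤; +-monoˡ-<; +-comm; +-suc; *-assoc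
        ; m+n≤o⇒m≤o∸n; m+n∸m≡n; m+n∸n≡m; m+[n∸m]≡n; *-distribˡ-∸ )
open import Data.Nat.Tactic.RingSolver using (solve)
open import Data.Integer using (ℤ; +_; 0ℤ; 1ℤ; -1ℤ) renaming (_+_ to _+ℤ_; _*_ to _*ℤ_)
import Data.Integer.Properties as ℤ
open import Data.List using (List; _∷_; [])
open import Data.Product using (_×_; _,_)
open import Data.Sum using (_⊎_; inj₁; inj₂)
open import Relation.Binary using (tri<; tri≈; tri>)
open import Relation.Binary.PropositionalEquality
open import Relation.Nullary using (Dec; yes; no; contradiction)

private
  variable
    f g : Ser
    c d e k l m m′ : ℕ
    x y : ℤ

*-vanishesˡ : ∀ y → x ≡ 0ℤ → x *ℤ y ≡ 0ℤ
*-vanishesˡ y refl = ℤ.*-zeroˡ y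

*-vanishesʳ : ∀ x → y ≡ 0ℤ → x *ℤ y ≡ 0ℤ
*-vanishesʳ x refl = ℤ.*-zeroʳ x

sumTo-vanishes : ∀ n (h : ℕ → ℤ) → (∀ i → i ≤ n → h i ≡ 0ℤ) → sumTo n h ≡ 0ℤ
sumTo-vanishes zero    h h≡0 = h≡0 0 z≤n
sumTo-vanishes (suc n) h h≡0 =
  cong₂ _+ℤ_ (sumTo-vanishes n h λ i i≤n → h≡0 i (m≤n⇒m≤1+n i≤n)) (h≡0 (suc n) ≤-refl)

sumTo-cong : ∀ n (h h′ : ℕ → ℤ) → (∀ i → i ≤ n → h i ≡ h′ i) → sumTo n h ≡ sumTo n h′
sumTo-cong zero    h h′ h≡h′ = h≡h′ 0 z≤n
sumTo-cong (suc n) h h′ h≡h′ =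
  cong₂ _+ℤ_ (sumTo-cong n h h′ λ i i≤n → h≡h′ i (m≤n⇒m≤1+n i≤n)) (h≡h′ (suc n) ≤-refl)

sumTo-single : ∀ n (h : ℕ → ℤ) {j} → j ≤ n → (∀ i → i ≤ n → i ≢ j → h i ≡ 0ℤ) → sumTo n h ≡ h j
sumTo-single zero    h z≤n       _   = refl
sumTo-single (suc n) h {j} j≤1+n h≡0 with j ≟ suc n
... | yes refl = begin
  sumTo n h +ℤ h (suc n) ≡⟨ cong (_+ℤ h (suc n)) (sumTo-vanishes n h λ i i≤n → h≡0 i (m≤n⇒m≤1+n i≤n) (<⇒≢ (s≤s i≤n))) ⟩
  0ℤ +ℤ h (suc n)        ≡⟨ ℤ.+-identityˡ _ ⟩
  h (suc n)              ∎
  where open ≡-Reasoning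
... | no j≢1+n = begin
  sumTo n h +ℤ h (suc n) ≡⟨ cong₂ _+ℤ_ (sumTo-single n h (≤-pred (≤∧≢⇒< j≤1+n j≢1+n)) λ i i≤n → h≡0 i (m≤n⇒m≤1+n i≤n))
                                      (h≡0 (suc n) ≤-refl λ 1+n≡j → j≢1+n (sym 1+n≡j)) ⟩
  h j +ℤ 0ℤ              ≡⟨ ℤ.+-identityʳ _ ⟩
  h j                    ∎
  where open ≡-Reasoning

monomial : ℕ → ℤ → ℕ → ℤ
monomial m x i with i ≟ m
... | yes _ = x
... | no  _ = 0ℤ

monomial-≡ : ∀ m x → monomial m x m ≡ x
monomial-≡ m x with m ≟ m
... | yes _   = refl
... | no  m≢m = contradiction refl m≢m

monomial-≢ : ∀ {i} x → i ≢ m → monomial m x i ≡ 0ℤ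
monomial-≢ {m} {i} x i≢m with i ≟ m
... | yes i≡m = contradiction i≡m i≢m
... | no  _   = refl

monomial-zero : ∀ m i → monomial m 0ℤ i ≡ 0ℤ
monomial-zero m i with i ≟ m
... | yes _ = refl
... | no  _ = refl

monomial-+ : ∀ m x y i → monomial m x i +ℤ monomial m y i ≡ monomial m (x +ℤ y) i
monomial-+ m x y i with i ≟ m
... | yes _ = refl
... | no  _ = refl

monomial-convolution : ∀ a m m′ x y →
  sumTo a (λ i → monomial m x i *ℤ monomial m′ y (a ∸ i)) ≡ monomial (m + m′) (x *ℤ y) a
monomial-convolution a m m′ x y with a ≟ m + m′
... | yes refl = begin
  sumTo (m + m′) (λ i → monomial m x i *ℤ monomial m′ y (m + m′ ∸ i))
    ≡⟨ sumTo-single (m + m′) _ (m≤m+n m m′) (λ i _ i≢m → *-vanishesˡ _ (monomial-≢ x i≢m)) ⟩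
  monomial m x m *ℤ monomial m′ y (m + m′ ∸ m)
    ≡⟨ cong₂ _*ℤ_ (monomial-≡ m x) (cong (monomial m′ y) (m+n∸m≡n m m′)) ⟩
  x *ℤ monomial m′ y m′
    ≡⟨ cong (x *ℤ_) (monomial-≡ m′ y) ⟩
  x *ℤ y ∎
  where open ≡-Reasoning
... | no a≢m+m′ = sumTo-vanishes a _ λ i i≤a → summand-vanishes i i≤a (i ≟ m)
  where
  summand-vanishes : ∀ i → i ≤ a → Dec (i ≡ m) → monomial m x i *ℤ monomial m′ y (a ∸ i) ≡ 0ℤ
  summand-vanishes i _   (no i≢m)  = *-vanishesˡ _ (monomial-≢ x i≢m)
  summand-vanishes i i≤a (yes refl) = *-vanishesʳ (monomial i x i) (monomial-≢ y λ a∸i≡m′ →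
    a≢m+m′ (trans (sym (m+[n∸m]≡n i≤a)) (cong (_+_ i) a∸i≡m′)))

DegU3≤ : Ser → ℕ → Set
DegU3≤ f d = ∀ a b k → d < k → f a b k ≡ 0ℤ

⊗-summand-vanishes : DegU3≤ f d → DegU3≤ g e → d < k ⊎ e < l →
                     ∀ a b a′ b′ → f a b k *ℤ g a′ b′ l ≡ 0ℤ
⊗-summand-vanishes {g = g} {l = l} f≤d _ (inj₁ d<k) a b a′ b′ = *-vanishesˡ (g a′ b′ l) (f≤d a b _ d<k)
⊗-summand-vanishes {f = f} {k = k} _ g≤e (inj₂ e<l) a b a′ b′ = *-vanishesʳ (f a b k) (g≤e a′ b′ _ e<l)

m+n<o⇒n<o∸m : k + e < c → e < c ∸ k
m+n<o⇒n<o∸m {k} {e} {c} k+e<c = m+n≤o⇒m≤o∸n (suc e) (subst (_≤ c) (cong suc (+-comm k e)) k+e<c)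

⊗-DegU3≤ : DegU3≤ f d → DegU3≤ g e → DegU3≤ (f ⊗ g) (d + e)
⊗-DegU3≤ {d = d} {e = e} f≤d g≤e a b c d+e<c =
  sumTo-vanishes a _ λ i _ → sumTo-vanishes b _ λ j _ → sumTo-vanishes c _ λ k _ →
    ⊗-summand-vanishes f≤d g≤e (split k) i j (a ∸ i) (b ∸ j)
  where
  split : ∀ k → d < k ⊎ e < c ∸ k
  split k with ≤-<-connex k d
  ... | inj₁ k≤d = inj₂ (m+n<o⇒n<o∸m (≤-trans (s≤s (+-monoˡ-≤ e k≤d)) d+e<c))
  ... | inj₂ d<k = inj₁ d<k

⊗-top-coefficient : DegU3≤ f d → DegU3≤ g e → ∀ a b →
  (f ⊗ g) a b (d + e) ≡ sumTo a λ i → sumTo b λ j → f i j d *ℤ g (a ∸ i) (b ∸ j) e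
⊗-top-coefficient {f = f} {d = d} {g = g} {e = e} f≤d g≤e a b =
  sumTo-cong a _ _ λ i _ → sumTo-cong b _ _ λ j _ → begin
    sumTo (d + e) (λ k → f i j k *ℤ g (a ∸ i) (b ∸ j) (d + e ∸ k))
      ≡⟨ sumTo-single (d + e) _ (m≤m+n d e) (λ k _ k≢d →
           ⊗-summand-vanishes f≤d g≤e (split k k≢d) i j (a ∸ i) (b ∸ j)) ⟩
    f i j d *ℤ g (a ∸ i) (b ∸ j) (d + e ∸ d)
      ≡⟨ cong (λ l → f i j d *ℤ g (a ∸ i) (b ∸ j) l) (m+n∸m≡n d e) ⟩
    f i j d *ℤ g (a ∸ i) (b ∸ j) e ∎
  where
  open ≡-Reasoning
  split : ∀ k → k ≢ d → d < k ⊎ e < d + e ∸ k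
  split k k≢d with <-cmp k d
  ... | tri> _ _ d<k = inj₁ d<k
  ... | tri≈ _ k≡d _ = contradiction k≡d k≢d
  ... | tri< k<d _ _ = inj₂ (m+n<o⇒n<o∸m (+-monoˡ-< e k<d))

record Leading (f : Ser) (d m : ℕ) (x : ℤ) : Set where
  field
    bounded : DegU3≤ f d
    top     : ∀ i → f i 0 d ≡ monomial m x i
open Leading

infixl 6 _⊕ᴸ_
infixl 7 _⊗ᴸ_

_⊗ᴸ_ : Leading f d m x → Leading g e m′ y → Leading (f ⊗ g) (d + e) (m + m′) (x *ℤ y)
_⊗ᴸ_ {f} {d} {m} {x} {g} {e} {m′} {y} Lf Lg = record
  { bounded = ⊗-DegU3≤ (bounded Lf) (bounded Lg)
  ; top     = λ a → begin
      (f ⊗ g) a 0 (d + e)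
        ≡⟨ ⊗-top-coefficient (bounded Lf) (bounded Lg) a 0 ⟩
      sumTo a (λ i → f i 0 d *ℤ g (a ∸ i) 0 e)
        ≡⟨ sumTo-cong a _ _ (λ i _ → cong₂ _*ℤ_ (top Lf i) (top Lg (a ∸ i))) ⟩
      sumTo a (λ i → monomial m x i *ℤ monomial m′ y (a ∸ i))
        ≡⟨ monomial-convolution a m m′ x y ⟩
      monomial (m + m′) (x *ℤ y) a ∎
  }
  where open ≡-Reasoning

_⊕ᴸ_ : Leading f d m x → Leading g d m y → Leading (f ⊕ g) d m (x +ℤ y)
_⊕ᴸ_ {m = m} {x} {y = y} Lf Lg = record
  { bounded = λ a b k d<k → cong₂ _+ℤ_ (bounded Lf a b k d<k) (bounded Lg a b k d<k)
  ; top     = λ i → trans (cong₂ _+ℤ_ (top Lf i) (top Lg i)) (monomial-+ m x y i)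
  }

Leading-below : DegU3≤ f d → d < e → Leading f e m 0ℤ
Leading-below {m = m} f≤d d<e = record
  { bounded = λ a b k e<k → f≤d a b k (<-trans d<e e<k)
  ; top     = λ i → trans (f≤d i 0 _ d<e) (sym (monomial-zero m i))
  }

Leading-zero : Leading f d m 0ℤ → Leading f d m′ 0ℤ
Leading-zero {m = m} {m′ = m′} Lf = record
  { bounded = bounded Lf
  ; top     = λ i → trans (top Lf i) (trans (monomial-zero m i) (sym (monomial-zero m′ i)))
  }

Leading-cast : Leading f d m x → d ≡ e → m ≡ m′ → Leading f e m′ x
Leading-cast Lf refl refl = Lf

Leading⇒DegU3 : Leading f d m x → x ≢ 0ℤ → DegU3 f d
Leading⇒DegU3 {m = m} {x} Lf x≢0 =
  (m , 0 , λ fm0d≡0 → x≢0 (trans (sym (monomial-≡ m x)) (trans (sym (top Lf m)) fm0d≡0))) , bounded Lf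

Leading-cst : ∀ z → Leading (cst z) 0 0 z
Leading-cst z = record { bounded = bounded′ ; top = top′ }
  where
  bounded′ : DegU3≤ (cst z) 0
  bounded′ zero    zero    (suc _) _ = refl
  bounded′ zero    (suc _) (suc _) _ = refl
  bounded′ (suc _) _       (suc _) _ = refl
  top′ : ∀ i → cst z i 0 0 ≡ monomial 0 z i
  top′ zero    = refl
  top′ (suc _) = refl

Leading-u₁ : Leading u₁ 0 1 1ℤ
Leading-u₁ = record { bounded = bounded′ ; top = top′ }
  where
  bounded′ : DegU3≤ u₁ 0
  bounded′ zero          _       (suc _) _ = refl
  bounded′ (suc zero)    zero    (suc _) _ = refl
  bounded′ (suc zero)    (suc _) (suc _) _ = refl
  bounded′ (suc (suc _)) _       (suc _) _ = refl
  top′ : ∀ i → u₁ i 0 0 ≡ monomial 1 1ℤ i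
  top′ zero          = refl
  top′ (suc zero)    = refl
  top′ (suc (suc _)) = refl

Leading-u₂ : Leading u₂ 0 0 0ℤ
Leading-u₂ = record { bounded = bounded′ ; top = top′ }
  where
  bounded′ : DegU3≤ u₂ 0
  bounded′ zero    zero          (suc _) _ = refl
  bounded′ zero    (suc zero)    (suc _) _ = refl
  bounded′ zero    (suc (suc _)) (suc _) _ = refl
  bounded′ (suc _) _             (suc _) _ = refl
  top′ : ∀ i → u₂ i 0 0 ≡ monomial 0 0ℤ i
  top′ zero    = refl
  top′ (suc _) = refl

Leading-u₃ : Leading u₃ 1 0 1ℤ
Leading-u₃ = record { bounded = bounded′ ; top = top′ }
  where
  bounded′ : DegU3≤ u₃ 1
  bounded′ zero    zero    (suc (suc _)) _ = refl
  bounded′ zero    (suc _) (suc (suc _)) _ = refl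
  bounded′ (suc _) _       (suc (suc _)) _ = refl
  bounded′ _       _       (suc zero)    (s≤s ())
  top′ : ∀ i → u₃ i 0 1 ≡ monomial 0 1ℤ i
  top′ zero    = refl
  top′ (suc _) = refl

Leading-u₃^ : ∀ N → Leading (u₃ ^ˢ N) N 0 1ℤ
Leading-u₃^ zero    = Leading-cst 1ℤ
Leading-u₃^ (suc N) = Leading-u₃ ⊗ᴸ Leading-u₃^ N

Leading-s : Leading sˢ 0 1 1ℤ
Leading-s = Leading-u₁ ⊕ᴸ Leading-zero Leading-u₂

Leading-p : Leading pˢ 0 1 0ℤ
Leading-p = Leading-u₁ ⊗ᴸ Leading-u₂

record Invariant (n : ℕ) : Set where
  field
    degB gap expA    : ℕ
    degB+1+gap≡2·3ⁿ : degB + suc gap ≡ 2 * 3 ^ n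
    2ⁿ⁺¹≡1+gap      : 2 ^ suc n ≡ suc gap
    A-leading       : Leading (errM1 n) (degB + gap) expA 1ℤ
    B-leading       : Leading (err0 n) degB (suc expA) 1ℤ
    C-leading       : Leading (err1 n) degB expA 1ℤ

module Step {n d k m : ℕ} (2ⁿ⁺¹≡1+k : 2 ^ suc n ≡ suc k)
  (Aᴸ : Leading (errM1 n) (d + k) m 1ℤ)
  (Bᴸ : Leading (err0 n) d (suc m) 1ℤ)
  (Cᴸ : Leading (err1 n) d m 1ℤ) where

  vars : List ℕ
  vars = d ∷ k ∷ m ∷ []

  q : Leading (u₃ ^ˢ (2 ^ suc n)) (suc k) 0 1ℤ
  q = Leading-cast (Leading-u₃^ _) 2ⁿ⁺¹≡1+k refl

  q² : Leading (u₃ ^ˢ (2 ^ suc (suc n))) (2 * suc k) 0 1ℤ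
  q² = Leading-cast (Leading-u₃^ _) (cong (2 *_) 2ⁿ⁺¹≡1+k) refl

  u₃q : Leading (u₃ ^ˢ (1 + 2 ^ suc n)) (suc (suc k)) 0 1ℤ
  u₃q = Leading-cast (Leading-u₃^ _) (cong suc 2ⁿ⁺¹≡1+k) refl

  A-next : Leading (errM1 (suc n)) (d + k + suc (suc (d + k + (d + k)))) (m + (suc m + suc m)) 1ℤ
  A-next = Aᴸ ⊗ᴸ
    (  Leading-below (bounded (Aᴸ ⊗ᴸ Aᴸ)) (n≤1+n _)
    ⊕ᴸ Leading-below (bounded (Leading-cst -1ℤ ⊗ᴸ Aᴸ ⊗ᴸ Aᴸ ⊗ᴸ Leading-s ⊗ᴸ Leading-u₃)) (≤-reflexive (solve vars))
    ⊕ᴸ Leading-zero (Leading-cast (Aᴸ ⊗ᴸ Aᴸ ⊗ᴸ Leading-p ⊗ᴸ (Leading-u₃ ⊗ᴸ Leading-u₃)) (solve vars) refl)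
    ⊕ᴸ Leading-below (bounded (Leading-cst (+ 3) ⊗ᴸ Aᴸ ⊗ᴸ Bᴸ ⊗ᴸ q)) (≤-reflexive (solve vars))
    ⊕ᴸ Leading-cast (Leading-cst (+ 2) ⊗ᴸ Bᴸ ⊗ᴸ Bᴸ ⊗ᴸ q²) (solve vars) (solve vars)
    ⊕ᴸ Leading-cast (Leading-cst -1ℤ ⊗ᴸ Aᴸ ⊗ᴸ Bᴸ ⊗ᴸ Leading-s ⊗ᴸ u₃q) (solve vars) (solve vars)
    ⊕ᴸ Leading-zero (Leading-cast (Leading-cst -1ℤ ⊗ᴸ Aᴸ ⊗ᴸ Cᴸ ⊗ᴸ Leading-p ⊗ᴸ u₃q) (solve vars) refl))

  B-next : Leading (err0 (suc n)) (d + suc (d + k + d)) (suc m + (suc m + suc m)) 1ℤ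
  B-next = Bᴸ ⊗ᴸ
    (  Leading-below (bounded (Aᴸ ⊗ᴸ Bᴸ)) (n<1+n _)
    ⊕ᴸ Leading-zero (Leading-cast (Leading-cst -1ℤ ⊗ᴸ Aᴸ ⊗ᴸ Cᴸ ⊗ᴸ Leading-p ⊗ᴸ Leading-u₃) (solve vars) refl)
    ⊕ᴸ Leading-cast (Bᴸ ⊗ᴸ Bᴸ ⊗ᴸ q) (solve vars) (solve vars))

  C-next : Leading (err1 (suc n)) (d + suc (d + k + d)) (suc m + (m + suc m)) 1ℤ
  C-next = Bᴸ ⊗ᴸ
    (  Leading-below (bounded (Aᴸ ⊗ᴸ Cᴸ)) (n<1+n _)
    ⊕ᴸ Leading-cast (Aᴸ ⊗ᴸ Bᴸ ⊗ᴸ Leading-u₃) (solve vars) (solve vars)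
    ⊕ᴸ Leading-cast (Leading-cst -1ℤ ⊗ᴸ Aᴸ ⊗ᴸ Cᴸ ⊗ᴸ Leading-s ⊗ᴸ Leading-u₃) (solve vars) (solve vars)
    ⊕ᴸ Leading-cast (Bᴸ ⊗ᴸ Cᴸ ⊗ᴸ q) (solve vars) (solve vars))

step : ∀ {n} → Invariant n → Invariant (suc n)
step {n} record { degB = d ; gap = k ; expA = m ; degB+1+gap≡2·3ⁿ = deg-eq ; 2ⁿ⁺¹≡1+gap = pow-eq
                ; A-leading = Aᴸ ; B-leading = Bᴸ ; C-leading = Cᴸ } = record
  { degB            = d + suc (d + k + d)
  ; gap             = suc (k + k)
  ; expA            = m + (suc m + suc m)
  ; degB+1+gap≡2·3ⁿ = begin
      d + suc (d + k + d) + suc (suc (k + k)) ≡⟨ solve (d ∷ k ∷ []) ⟩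
      3 * (d + suc k)                         ≡⟨ cong (3 *_) deg-eq ⟩
      3 * (2 * 3 ^ n)                         ≡⟨ sym (*-assoc 3 2 (3 ^ n)) ⟩
      6 * 3 ^ n                               ≡⟨ *-assoc 2 3 (3 ^ n) ⟩
      2 * 3 ^ suc n                           ∎
  ; 2ⁿ⁺¹≡1+gap      = trans (cong (2 *_) pow-eq) (solve (k ∷ []))
  ; A-leading       = Leading-cast A-next (solve (d ∷ k ∷ [])) refl
  ; B-leading       = B-next
  ; C-leading       = Leading-cast C-next refl (solve (m ∷ []))
  }
  where
  open ≡-Reasoning
  open Step {n} pow-eq Aᴸ Bᴸ Cᴸ

invariant : ∀ n → Invariant n
invariant zero = record
  { degB            = 0
  ; gap             = 1
  ; expA            = 1
  ; degB+1+gap≡2·3ⁿ = refl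
  ; 2ⁿ⁺¹≡1+gap      = refl
  ; A-leading       = Leading-below (bounded (Leading-cst 1ℤ)) (n<1+n 0) ⊕ᴸ Leading-u₃ ⊗ᴸ Leading-s
  ; B-leading       = Leading-u₁ ⊗ᴸ Leading-u₁ ⊕ᴸ Leading-zero Leading-p ⊕ᴸ Leading-zero (Leading-u₂ ⊗ᴸ Leading-u₂)
  ; C-leading       = Leading-s
  }
invariant (suc n) = step (invariant n)

lemma2p1 : (n : ℕ) →
    DegU3 (errM1 n) (2 * 3 ^ n ∸ 1) ×
    DegU3 (err0 n) (2 * (3 ^ n ∸ 2 ^ n)) ×
    DegU3 (err1 n) (2 * (3 ^ n ∸ 2 ^ n))
lemma2p1 n =
  subst (DegU3 (errM1 n)) degA≡ (Leading⇒DegU3 A-leading λ ()) ,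
  subst (DegU3 (err0 n))  degB≡ (Leading⇒DegU3 B-leading λ ()) ,
  subst (DegU3 (err1 n))  degB≡ (Leading⇒DegU3 C-leading λ ())
  where
  open Invariant (invariant n)
  open ≡-Reasoning
  degA≡ : degB + gap ≡ 2 * 3 ^ n ∸ 1
  degA≡ = cong (_∸ 1) (trans (sym (+-suc degB gap)) degB+1+gap≡2·3ⁿ)
  degB≡ : degB ≡ 2 * (3 ^ n ∸ 2 ^ n)
  degB≡ = begin
    degB                         ≡⟨ m+n∸n≡m degB (suc gap) ⟨
    degB + suc gap ∸ suc gap     ≡⟨ cong₂ _∸_ degB+1+gap≡2·3ⁿ (sym 2ⁿ⁺¹≡1+gap) ⟩
    2 * 3 ^ n ∸ 2 * 2 ^ n        ≡⟨ *-distribˡ-∸ 2 (3 ^ n) (2 ^ n) ⟨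
    2 * (3 ^ n ∸ 2 ^ n)          ∎
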